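{- Let $G$ be a ribbon graph and $e\in E(G)$. If $G$ is checkerboard colourable, then $G/e$ is checkerboard colourable.
   Context: A ribbon graph is a (possibly non-orientable) surface with boundary written as a union of vertex discs and edge discs meeting in disjoint line segments (common line segments), each lying on exactly one vertex and one edge, each edge containing exactly two. The two boundary arcs of an edge disc other than its common line segments are its edge line segments. $G$ is checkerboard colourable if its boundary components can be coloured with two colours so that the two edge line segments of each edge receive different colours. $G/e$ is the contraction of $e$, defined as $G^{\delta(e)}-e$, where $G^{\delta(e)}$ is the partial dual with respect to $e$ (in the arrow presentation, with arrows $e',e''$ of $e$: draw segments directed from the head of $e'$ to the tail of $e''$ and from the head of $e''$ to the tail of $e'$, both labelled $e$, and delete the arcs carrying $e',e''$). -}

module Defs where

-- Ribbon graphs are encoded combinatorially by their flags (graph-encoded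
-- maps / gems).  Each edge disc is cut into four flags (one per end of the
-- edge and per side of the edge).  Three involutions act on flags:
--   τ₀ : move to the other end of the edge, same side   (same edge line segment)
--   τ₁ : move around the vertex corner to the next edge-end (same vertex, same boundary comp.)
--   τ₂ : move to the other side of the edge, same end    (same edge, same vertex)
-- Vertices = ⟨τ₁,τ₂⟩-orbits, edges = ⟨τ₀,τ₂⟩-orbits (4 flags each),
-- boundary components = ⟨τ₀,τ₁⟩-orbits; an edge line segment is a pair {x, τ₀ x}
-- and the two edge line segments of an edge are exchanged by τ₂.
-- Flags may be marked absent (needed to express edge deletion without
-- re-indexing): only flags with  present x ≡ true  belong to the structure.

open import Data.Nat using (ℕ)
open import Data.Fin using (Fin; _≟_)
open import Data.Bool using (Bool; true; false; _∧_; _∨_; not; if_then_else_)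
open import Data.Product using (Σ; _×_)
open import Relation.Nullary using (¬_)
open import Relation.Nullary.Decidable using (⌊_⌋)
open import Relation.Binary.PropositionalEquality using (_≡_; _≢_)

record FlagStructure : Set where
  field
    n       : ℕ
    present : Fin n → Bool
    τ₀ τ₁ τ₂ : Fin n → Fin n
open FlagStructure public

record IsRibbonGraph (G : FlagStructure) : Set where
  field
    closed₀ : ∀ x → present G x ≡ true → present G (τ₀ G x) ≡ true
    closed₁ : ∀ x → present G x ≡ true → present G (τ₁ G x) ≡ true
    closed₂ : ∀ x → present G x ≡ true → present G (τ₂ G x) ≡ true
    invol₀ : ∀ x → present G x ≡ true → τ₀ G (τ₀ G x) ≡ x
    invol₁ : ∀ x → present G x ≡ true → τ₁ G (τ₁ G x) ≡ x
    invol₂ : ∀ x → present G x ≡ true → τ₂ G (τ₂ G x) ≡ x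
    fpf₀ : ∀ x → present G x ≡ true → τ₀ G x ≢ x
    fpf₁ : ∀ x → present G x ≡ true → τ₁ G x ≢ x
    fpf₂ : ∀ x → present G x ≡ true → τ₂ G x ≢ x
    comm₀₂ : ∀ x → present G x ≡ true → τ₀ G (τ₂ G x) ≡ τ₂ G (τ₀ G x)
    fpf₀₂ : ∀ x → present G x ≡ true → τ₀ G x ≢ τ₂ G x

-- An edge of G is named by any one of its (present) flags e.
-- inEdge G e x : x is one of the four flags of the edge containing e.
inEdge : (G : FlagStructure) → Fin (n G) → Fin (n G) → Bool
inEdge G e x = ⌊ x ≟ e ⌋ ∨ ⌊ x ≟ τ₀ G e ⌋ ∨ ⌊ x ≟ τ₂ G e ⌋ ∨ ⌊ x ≟ τ₀ G (τ₂ G e) ⌋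

-- Partial dual G^{δ(e)} with respect to the single edge e:
-- on the flags of e, τ₀ and τ₂ are exchanged (the gem form of partial duality).
partialDual : (G : FlagStructure) → Fin (n G) → FlagStructure
partialDual G e = record
  { n = n G
  ; present = present G
  ; τ₀ = λ x → if inEdge G e x then τ₂ G x else τ₀ G x
  ; τ₁ = τ₁ G
  ; τ₂ = λ x → if inEdge G e x then τ₀ G x else τ₂ G x
  }

-- Deletion G - e: remove the four flags of e and reconnect the vertex corners:
-- the new τ₁ of a flag x follows the vertex boundary (alternating τ₁, τ₂)
-- past the flags of e.  Since e has 4 flags, at most two passes are needed.
deleteEdge : (G : FlagStructure) → Fin (n G) → FlagStructure
deleteEdge G e = record
  { n = n G
  ; present = λ x → present G x ∧ not (inEdge G e x)
  ; τ₀ = τ₀ G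
  ; τ₁ = τ₁'
  ; τ₂ = τ₂ G
  }
  where
  step : Fin (n G) → Fin (n G)
  step y = τ₁ G (τ₂ G y)
  τ₁' : Fin (n G) → Fin (n G)
  τ₁' x = if inEdge G e (τ₁ G x)
            then (if inEdge G e (step (τ₁ G x)) then step (step (τ₁ G x)) else step (τ₁ G x))
            else τ₁ G x

contract : (G : FlagStructure) → Fin (n G) → FlagStructure
contract G e = deleteEdge (partialDual G e) e

-- Checkerboard colourable: a 2-colouring of boundary components (a colouring of
-- flags constant along τ₀ and τ₁, i.e. on ⟨τ₀,τ₁⟩-orbits) such that the two edge
-- line segments of every edge (exchanged by τ₂) get different colours.
CheckerboardColourable : FlagStructure → Set
CheckerboardColourable G =
  Σ (Fin (n G) → Bool) λ c →
    ∀ x → present G x ≡ true →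
      (c (τ₀ G x) ≡ c x) × (c (τ₁ G x) ≡ c x) × (c (τ₂ G x) ≢ c x)

-- Contraction keeps the boundary of a ribbon graph away from e intact: every
-- boundary component of G/e is obtained from one of G by shortcutting through
-- the flags of e, where the partial dual has turned the τ₂-steps across e into
-- τ₀-steps along an edge line segment of G.  Hence the colouring of G, restricted
-- to the surviving flags, is still constant on boundary components of G/e and
-- still separates the two edge line segments of every other edge.
module Submission where

open import Defs
open import Algebra.Bundles using (CommutativeMonoid)
open import Data.Bool using (Bool; true; false; _∨_)
open import Data.Bool.Properties using (∨-commutativeMonoid; ∨-zeroʳ)
open import Data.Fin using (Fin; _≟_)
open import Function using (_∘_)
open import Data.Product using (_,_; _×_; proj₁; proj₂)
open import Relation.Nullary.Decidable using (⌊_⌋)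
open import Relation.Binary.PropositionalEquality

open import Algebra.Properties.CommutativeSemigroup
  (CommutativeMonoid.commutativeSemigroup ∨-commutativeMonoid) using (x∙yz≈y∙xz)

module _ (G : FlagStructure) (e : Fin (n G)) where

  present-deleteEdge : ∀ {x} → present (deleteEdge G e) x ≡ true →
    present G x ≡ true × inEdge G e x ≡ false
  present-deleteEdge {x} p with present G x | inEdge G e x
  ... | true | false = refl , refl

  deleteEdge-τ₁-colour : (c : Fin (n G) → Bool) →
    (∀ x → present G x ≡ true → present G (τ₁ G x) ≡ true × c (τ₁ G x) ≡ c x) →
    (∀ y → present G y ≡ true → inEdge G e y ≡ true →
       present G (τ₁ G (τ₂ G y)) ≡ true × c (τ₁ G (τ₂ G y)) ≡ c y) →
    ∀ x → present G x ≡ true → c (τ₁ (deleteEdge G e) x) ≡ c x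
  deleteEdge-τ₁-colour c corner across x px
    with inEdge G e (τ₁ G x) in i₁
  ... | false = proj₂ (corner x px)
  ... | true with across (τ₁ G x) (proj₁ (corner x px)) i₁
  ...   | p₂ , c₂ with inEdge G e (τ₁ G (τ₂ G (τ₁ G x))) in i₂
  ...     | false = trans c₂ (proj₂ (corner x px))
  ...     | true = trans (proj₂ (across _ p₂ i₂)) (trans c₂ (proj₂ (corner x px)))

module _ (G : FlagStructure) (e : Fin (n G)) where

  inEdge-self : inEdge G e e ≡ true
  inEdge-self rewrite ≡-≟-identity _≟_ {e} refl = refl

  inEdge-τ₀ : inEdge G e (τ₀ G e) ≡ true
  inEdge-τ₀ rewrite ≡-≟-identity _≟_ {τ₀ G e} refl = ∨-zeroʳ _

  inEdge-partialDual : τ₀ G (τ₂ G e) ≡ τ₂ G (τ₀ G e) →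
    ∀ x → inEdge (partialDual G e) e x ≡ inEdge G e x
  inEdge-partialDual comm x rewrite inEdge-self | inEdge-τ₀ | sym comm =
    cong (⌊ x ≟ e ⌋ ∨_) (x∙yz≈y∙xz ⌊ x ≟ τ₂ G e ⌋ ⌊ x ≟ τ₀ G e ⌋ _)

  partialDual-τ₀-off : ∀ {x} → inEdge G e x ≡ false → τ₀ (partialDual G e) x ≡ τ₀ G x
  partialDual-τ₀-off ix rewrite ix = refl

  partialDual-τ₂-off : ∀ {x} → inEdge G e x ≡ false → τ₂ (partialDual G e) x ≡ τ₂ G x
  partialDual-τ₂-off ix rewrite ix = refl

  partialDual-τ₂-on : ∀ {x} → inEdge G e x ≡ true → τ₂ (partialDual G e) x ≡ τ₀ G x
  partialDual-τ₂-on ix rewrite ix = refl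

  present-contract : τ₀ G (τ₂ G e) ≡ τ₂ G (τ₀ G e) →
    ∀ {x} → present (contract G e) x ≡ true → present G x ≡ true × inEdge G e x ≡ false
  present-contract comm {x} px with present-deleteEdge (partialDual G e) e px
  ... | px' , ix = px' , trans (sym (inEdge-partialDual comm x)) ix

lemma4p1 : (G : FlagStructure) → IsRibbonGraph G → (e : Fin (n G)) → present G e ≡ true →
    CheckerboardColourable G → CheckerboardColourable (contract G e)
lemma4p1 G R e pe (c , hc) = c , λ x px → survivor (present-contract G e (comm₀₂ e pe) px)
  where
  open IsRibbonGraph R
  G' = partialDual G e

  corner : ∀ x → present G x ≡ true → present G (τ₁ G x) ≡ true × c (τ₁ G x) ≡ c x
  corner x px = closed₁ x px , proj₁ (proj₂ (hc x px))

  across : ∀ y → present G y ≡ true → inEdge G' e y ≡ true →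
    present G (τ₁ G (τ₂ G' y)) ≡ true × c (τ₁ G (τ₂ G' y)) ≡ c y
  across y py iy =
    subst (λ z → present G (τ₁ G z) ≡ true × c (τ₁ G z) ≡ c y) (sym (partialDual-τ₂-on G e iy'))
      (closed₁ _ (closed₀ y py) , trans (proj₁ (proj₂ (hc _ (closed₀ y py)))) (proj₁ (hc y py)))
    where iy' = trans (sym (inEdge-partialDual G e (comm₀₂ e pe) y)) iy

  survivor : ∀ {x} → present G x ≡ true × inEdge G e x ≡ false →
    (c (τ₀ (contract G e) x) ≡ c x) × (c (τ₁ (contract G e) x) ≡ c x) × (c (τ₂ (contract G e) x) ≢ c x)
  survivor {x} (px , ix) =
    trans (cong c (partialDual-τ₀-off G e ix)) (proj₁ (hc x px)) ,
    deleteEdge-τ₁-colour G' e c corner across x px ,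
    proj₂ (proj₂ (hc x px)) ∘ trans (cong c (sym (partialDual-τ₂-off G e ix)))
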